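{- For every integer $m\geq 2$, \[ f(m)\geq \left\lfloor\frac{m}{2}\right\rfloor\left\lceil\frac{m}{2}\right\rceil=\left\lfloor\frac{m^2}{4}\right\rfloor, \] where $f(m)=\sup_{\mathbf{P}}\dim(\mathbf{P})/B(\mathbf{P})$, the supremum taken over all $m$-partite posets $\mathbf{P}$.
   Context: All posets are finite. The order dimension $\dim(\mathbf{Q})$ of a poset $\mathbf{Q}=(X,\preceq)$ is the least number $d$ of linear extensions $\preceq_1,\ldots,\preceq_d$ of $\preceq$ such that for all $x,y\in X$: $x\preceq y$ iff $x\preceq_i y$ for all $i\in[d]$. For an integer $m\geq 2$ and disjoint nonempty sets $X_1,\ldots,X_m$, $\mathbf{P}=(X_1,\ldots,X_m;\preceq)$ is an $m$-partite poset if $\preceq$ is a partial order on $X=X_1\cup\cdots\cup X_m$ such that (1) each $X_i$ is an antichain, and (2) $x\prec y$ implies $x\in X_i$, $y\in X_j$ with $i<j$. Its dimension is that of $(X,\preceq)$. For $i<j$, $\mathbf{P}_{i,j}$ is the sub-poset induced on $X_i\cup X_j$, and $B(\mathbf{P})=\max_{i<j}\dim(\mathbf{P}_{i,j})$. -}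

module Defs where

open import Data.Nat using (ℕ; _≤_; _<_)
open import Data.Fin using (Fin) renaming (_<_ to _<ᶠ_)
open import Data.Product using (Σ; ∃; _×_)
open import Relation.Binary.PropositionalEquality using (_≡_; _≢_)

-- An m-partite poset on the ground set X = Fin n.
-- part x = i means x ∈ X_i (parts indexed by Fin m, i.e. X_1..X_m as 0..m-1).
record MPartitePoset (m : ℕ) : Set₁ where
  field
    n        : ℕ
    part     : Fin n → Fin m
    nonempty : (i : Fin m) → ∃ λ x → part x ≡ i
    _≼_      : Fin n → Fin n → Set
    ≼-refl   : ∀ x → x ≼ x
    ≼-antisym : ∀ {x y} → x ≼ y → y ≼ x → x ≡ y
    ≼-trans  : ∀ {x y z} → x ≼ y → y ≼ z → x ≼ z
    antichain : ∀ {x y} → x ≼ y → part x ≡ part y → x ≡ y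
    layered  : ∀ {x y} → x ≼ y → x ≢ y → part x <ᶠ part y

module _ {n : ℕ} (_≼_ : Fin n → Fin n → Set) (S : Fin n → Set) where

  -- A linear order on S is represented by an injective rank function
  -- σ : Fin n → ℕ (restricted to S): x ≤σ y iff σ x ≤ σ y.
  Realizer : ℕ → Set
  Realizer d =
    Σ (Fin d → Fin n → ℕ) λ σ →
      (∀ k {x y} → S x → S y → σ k x ≡ σ k y → x ≡ y)
      × (∀ k {x y} → S x → S y → x ≼ y → σ k x ≤ σ k y)
      × (∀ {x y} → S x → S y → (∀ k → σ k x ≤ σ k y) → x ≼ y)

  IsDim : ℕ → Set
  IsDim d = Realizer d × (∀ d' → Realizer d' → d ≤ d')

module _ {m : ℕ} (P : MPartitePoset m) where
  open MPartitePoset P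

  InPair : Fin m → Fin m → Fin n → Set
  InPair i j x = (part x ≡ i) Data.Sum.⊎ (part x ≡ j)
    where import Data.Sum

  DimP : ℕ → Set
  DimP d = IsDim _≼_ (λ _ → Data.Unit.⊤) d
    where import Data.Unit

  IsB : ℕ → Set
  IsB b =
    (∀ i j → i <ᶠ j → ∃ λ d → IsDim _≼_ (InPair i j) d × d ≤ b)
    × (∃ λ i → ∃ λ j → i <ᶠ j × IsDim _≼_ (InPair i j) b)

-- Let h = ⌊m/2⌋, c = ⌈m/2⌉ and N = 2hc. Take the standard example S_N (a_t < b_u iff t ≠ u,
-- of dimension N), index its N critical pairs by Fin h × Fin c × Fin 2, and put a_t in
-- part i and b_t in part h + j when t = (i, j, s). Two parts then contain both ends of at
-- most two critical pairs (a_k₀, b_k₀), (a_k₁, b_k₁), and two linear extensions suffice on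
-- them: list the a's in an order starting with k₁ and ending with k₀, put b_k₀ just below
-- a_k₀ and the remaining b's after all a's in the opposite order; the second extension swaps
-- the roles of the two orders and of k₀, k₁.
-- Hence dim P = 2hc while B(P) = 2.
module Submission where

open import Defs
open import Data.Fin as Fin using (Fin; toℕ; _↑ˡ_; _↑ʳ_; splitAt; join; combine; remQuot)
open import Data.Fin.Properties
  using (_≟_; toℕ<n; toℕ-injective; toℕ-↑ˡ; toℕ-↑ʳ; ↑ˡ-injective; ↑ʳ-injective;
         splitAt-join; join-splitAt; splitAt⁻¹-↑ˡ; splitAt⁻¹-↑ʳ;
         remQuot-combine; combine-remQuot; ¬∀⟶∃¬; injective⇒≤)
  renaming (<⇒≢ to <⇒≢ᶠ)
open import Data.Fin.Patterns using (0F; 1F)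
open import Data.Nat using (ℕ; zero; suc; _+_; _*_; _∸_; _≤_; _<_; _≤?_; s≤s; z≤n; s≤s⁻¹; ⌊_/2⌋; ⌈_/2⌉)
open import Data.Nat.Properties hiding (_≟_)
open import Data.Empty using (⊥)
open import Data.Product using (∃; Σ; _×_; _,_; proj₁; proj₂; uncurry)
open import Data.Sum using (_⊎_; inj₁; inj₂; [_,_])
open import Data.Unit using (⊤; tt)
open import Data.Vec.Functional using (updateAt)
open import Data.Vec.Functional.Properties using (updateAt-updates; updateAt-minimal)
open import Function using (_∘_; const)
open import Function.Definitions using (Injective)
open import Relation.Nullary using (¬_; yes; no; contradiction)
open import Relation.Binary.PropositionalEquality
  using (_≡_; _≢_; refl; sym; trans; cong; subst; subst₂; ≢-sym; module ≡-Reasoning)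

-- Rankings of a finite set

MaximalAt MinimalAt : ∀ {n} → (Fin n → ℕ) → Fin n → Set
MaximalAt f k = ∀ t → t ≢ k → f t < f k
MinimalAt f k = ∀ t → t ≢ k → f k < f t

another : ∀ {n} {k₀ k₁ : Fin n} → k₀ ≢ k₁ → ∀ t → ∃ λ u → t ≢ u
another {k₀ = k₀} {k₁} k₀≢k₁ t with t ≟ k₀
... | yes refl = k₁ , k₀≢k₁
... | no t≢k₀ = k₀ , t≢k₀

Opposite : ∀ {n} → (Fin n → ℕ) → (Fin n → ℕ) → Set
Opposite f g = ∀ {s t} → f s ≤ f t → g s ≤ g t → s ≡ t

module _ {n} {f : Fin n → ℕ} {k : Fin n} where

  maximalAt-unique : MaximalAt f k → ∀ {t} → f k ≤ f t → t ≡ k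
  maximalAt-unique max {t} fk≤ft with t ≟ k
  ... | yes t≡k = t≡k
  ... | no t≢k = contradiction fk≤ft (<⇒≱ (max t t≢k))

  minimalAt-unique : MinimalAt f k → ∀ {t} → f t ≤ f k → t ≡ k
  minimalAt-unique min {t} ft≤fk with t ≟ k
  ... | yes t≡k = t≡k
  ... | no t≢k = contradiction ft≤fk (<⇒≱ (min t t≢k))

  updateAt-injective : ∀ {v} → Injective _≡_ _≡_ f → (∀ t → t ≢ k → f t ≢ v) →
                       Injective _≡_ _≡_ (updateAt f k (const v))
  updateAt-injective f-inj fresh {s} {t} eq with s ≟ k | t ≟ k
  ... | yes refl | yes refl = refl
  ... | yes refl | no t≢k =
    contradiction (trans (sym (updateAt-minimal t k f t≢k)) (trans (sym eq) (updateAt-updates k f))) (fresh t t≢k)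
  ... | no s≢k | yes refl =
    contradiction (trans (sym (updateAt-minimal s k f s≢k)) (trans eq (updateAt-updates k f))) (fresh s s≢k)
  ... | no s≢k | no t≢k =
    f-inj (trans (sym (updateAt-minimal s k f s≢k)) (trans eq (updateAt-minimal t k f t≢k)))

module _ {n} {c : ℕ} {f : Fin n → ℕ} (f≤c : ∀ t → f t ≤ c) where

  complement-injective : Injective _≡_ _≡_ f → Injective _≡_ _≡_ (λ t → c ∸ f t)
  complement-injective f-inj {s} {t} = f-inj ∘ ∸-cancelˡ-≡ (f≤c s) (f≤c t)

  complement-opposite : Injective _≡_ _≡_ f → Opposite f (λ t → c ∸ f t)
  complement-opposite f-inj {s} {t} fs≤ft c∸fs≤c∸ft with m≤n⇒m<n∨m≡n fs≤ft
  ... | inj₁ fs<ft = contradiction c∸fs≤c∸ft (<⇒≱ (∸-monoʳ-< fs<ft (f≤c t)))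
  ... | inj₂ fs≡ft = f-inj fs≡ft

  complement-minimalAt : ∀ {k} → MaximalAt f k → MinimalAt (λ t → c ∸ f t) k
  complement-minimalAt {k} max t t≢k = ∸-monoʳ-< (max t t≢k) (f≤c k)

  complement-maximalAt : ∀ {k} → MinimalAt f k → MaximalAt (λ t → c ∸ f t) k
  complement-maximalAt min t t≢k = ∸-monoʳ-< (min t t≢k) (f≤c t)

-- The order toℕ with k₀ moved to the top and k₁ to the bottom.
module Pinned {n} {k₀ k₁ : Fin n} (k₀≢k₁ : k₀ ≢ k₁) where

  lowered pinned : Fin n → ℕ
  lowered = updateAt (suc ∘ toℕ) k₁ (const 0)
  pinned = updateAt lowered k₀ (const (suc n))

  lowered-< : ∀ t → lowered t < suc n
  lowered-< t with t ≟ k₁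
  ... | yes refl = subst (_< suc n) (sym (updateAt-updates k₁ (suc ∘ toℕ))) (s≤s z≤n)
  ... | no t≢k₁ = subst (_< suc n) (sym (updateAt-minimal t k₁ (suc ∘ toℕ) t≢k₁)) (s≤s (toℕ<n t))

  pinned-≤ : ∀ t → pinned t ≤ suc n
  pinned-≤ t with t ≟ k₀
  ... | yes refl = ≤-reflexive (updateAt-updates k₀ lowered)
  ... | no t≢k₀ = subst (_≤ suc n) (sym (updateAt-minimal t k₀ lowered t≢k₀)) (<⇒≤ (lowered-< t))

  pinned-injective : Injective _≡_ _≡_ pinned
  pinned-injective = updateAt-injective
    (updateAt-injective (toℕ-injective ∘ suc-injective) (λ _ _ ()))
    (λ t _ → <⇒≢ (lowered-< t))

  pinned-maximalAt : MaximalAt pinned k₀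
  pinned-maximalAt t t≢k₀ =
    subst₂ _<_ (sym (updateAt-minimal t k₀ lowered t≢k₀)) (sym (updateAt-updates k₀ lowered)) (lowered-< t)

  pinned-minimalAt : MinimalAt pinned k₁
  pinned-minimalAt t t≢k₁ = subst (_< pinned t) (sym pinned-k₁) pinned-positive
    where
    pinned-k₁ : pinned k₁ ≡ 0
    pinned-k₁ = trans (updateAt-minimal k₁ k₀ lowered (k₀≢k₁ ∘ sym)) (updateAt-updates k₁ (suc ∘ toℕ))
    pinned-positive : 0 < pinned t
    pinned-positive with t ≟ k₀
    ... | yes refl = subst (0 <_) (sym (updateAt-updates k₀ lowered)) (s≤s z≤n)
    ... | no t≢k₀ = subst (0 <_) (sym (trans (updateAt-minimal t k₀ lowered t≢k₀)
                                              (updateAt-minimal t k₁ (suc ∘ toℕ) t≢k₁))) (s≤s z≤n)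

-- The standard example S_N

Elem : ℕ → Set
Elem N = Fin N ⊎ Fin N

pattern a t = inj₁ t
pattern b t = inj₂ t

infix 4 _⊑_
_⊑_ : ∀ {N} → Elem N → Elem N → Set
a s ⊑ a t = s ≡ t
a s ⊑ b t = s ≢ t
b s ⊑ a t = ⊥
b s ⊑ b t = s ≡ t

module _ {N : ℕ} where

  ⊑-refl : ∀ (x : Elem N) → x ⊑ x
  ⊑-refl (a _) = refl
  ⊑-refl (b _) = refl

  ⊑-antisym : ∀ {x y : Elem N} → x ⊑ y → y ⊑ x → x ≡ y
  ⊑-antisym {a s} {a t} refl _ = refl
  ⊑-antisym {b s} {b t} refl _ = refl
  ⊑-antisym {a s} {b t} _ ()

  ⊑-trans : ∀ {x y z : Elem N} → x ⊑ y → y ⊑ z → x ⊑ z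
  ⊑-trans {a s} {a t} refl y⊑z = y⊑z
  ⊑-trans {b s} {b t} refl y⊑z = y⊑z
  ⊑-trans {a s} {b t} {b u} s≢t refl = s≢t

record LinearExtension (N : ℕ) : Set where
  field
    rank           : Elem N → ℕ
    rank-injective : Injective _≡_ _≡_ rank
    rank-monotone  : ∀ {x y} → x ⊑ y → rank x ≤ rank y

open LinearExtension

Realizes : ∀ {N d} → (Elem N → Set) → (Fin d → LinearExtension N) → Set
Realizes S L = ∀ {x y} → S x → S y → (∀ k → rank (L k) x ≤ rank (L k) y) → x ⊑ y

-- Each critical pair (a t, b t) is reversed by some extension, and one extension cannot
-- reverse two of them: b s < a s ≤ b t < a t ≤ b s.
standardExample-dim≥ : ∀ {N d} (L : Fin d → LinearExtension N) → Realizes (λ _ → ⊤) L → N ≤ d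
standardExample-dim≥ {N} {d} L realizes = injective⇒≤ reverser-injective
  where
  Keeps : Fin N → Fin d → Set
  Keeps t k = rank (L k) (a t) ≤ rank (L k) (b t)

  reversal : ∀ t → ∃ λ k → ¬ Keeps t k
  reversal t = ¬∀⟶∃¬ d (Keeps t) (λ k → _ ≤? _) (λ keeps → realizes tt tt keeps refl)

  reverser : Fin N → Fin d
  reverser = proj₁ ∘ reversal

  reverses : ∀ t → rank (L (reverser t)) (b t) < rank (L (reverser t)) (a t)
  reverses t = ≰⇒> (proj₂ (reversal t))

  reverser-injective : Injective _≡_ _≡_ reverser
  reverser-injective {s} {t} same with s ≟ t
  ... | yes s≡t = s≡t
  ... | no s≢t = contradiction (begin-strict
      rank (L k) (a s)  ≤⟨ rank-monotone (L k) s≢t ⟩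
      rank (L k) (b t)  <⟨ subst (λ k → rank (L k) (b t) < rank (L k) (a t)) (sym same) (reverses t) ⟩
      rank (L k) (a t)  ≤⟨ rank-monotone (L k) (s≢t ∘ sym) ⟩
      rank (L k) (b s)  ∎) (<-asym (reverses s))
    where
    open ≤-Reasoning
    k = reverser s

odd<even : ∀ {x y} → x < y → suc (2 * x) < 2 * y
odd<even {x} {y} x<y = subst (_≤ 2 * y) (*-suc 2 x) (*-monoʳ-≤ 2 x<y)

-- Odd ranks for the a's, even ranks for the b's: the a's in α-order with a k on top,
-- b k just below a k, and the other b's above every a in β-order.
module Reversing {N : ℕ} (B : ℕ) {α β : Fin N → ℕ} {k : Fin N}
  (α-injective : Injective _≡_ _≡_ α) (β-injective : Injective _≡_ _≡_ β)
  (α<B : ∀ t → α t < B) (α-max : MaximalAt α k) (β-min : MinimalAt β k) where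

  β⁺ : Fin N → ℕ
  β⁺ = updateAt (λ t → B + β t) k (const (α k))

  α<β⁺ : ∀ {s t} → s ≢ t → α s < β⁺ t
  α<β⁺ {s} {t} s≢t with t ≟ k
  ... | yes refl = subst (α s <_) (sym (updateAt-updates k _)) (α-max s s≢t)
  ... | no t≢k = subst (α s <_) (sym (updateAt-minimal t k _ t≢k)) (<-≤-trans (α<B s) (m≤m+n B (β t)))

  β⁺-injective : Injective _≡_ _≡_ β⁺
  β⁺-injective = updateAt-injective (β-injective ∘ +-cancelˡ-≡ B _ _)
    (λ t _ → ≢-sym (<⇒≢ (<-≤-trans (α<B k) (m≤m+n B (β t)))))

  β⁺-order : ∀ {s t} → β⁺ s ≤ β⁺ t → β s ≤ β t
  β⁺-order {s} {t} le with s ≟ k | t ≟ k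
  ... | yes refl | yes refl = ≤-refl
  ... | yes refl | no t≢k = <⇒≤ (β-min t t≢k)
  ... | no s≢k | yes refl = contradiction le (<⇒≱ (subst (_< β⁺ s) (sym (updateAt-updates k _)) (α<β⁺ (s≢k ∘ sym))))
  ... | no s≢k | no t≢k =
    +-cancelˡ-≤ B _ _ (subst₂ _≤_ (updateAt-minimal s k _ s≢k) (updateAt-minimal t k _ t≢k) le)

  rank₀ : Elem N → ℕ
  rank₀ (a t) = suc (2 * α t)
  rank₀ (b t) = 2 * β⁺ t

  rank₀-injective : Injective _≡_ _≡_ rank₀
  rank₀-injective {a s} {a t} eq = cong a (α-injective (*-cancelˡ-≡ _ _ 2 (suc-injective eq)))
  rank₀-injective {b s} {b t} eq = cong b (β⁺-injective (*-cancelˡ-≡ _ _ 2 eq))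
  rank₀-injective {a s} {b t} eq = contradiction (sym eq) (even≢odd (β⁺ t) (α s))
  rank₀-injective {b s} {a t} eq = contradiction eq (even≢odd (β⁺ s) (α t))

  rank₀-monotone : ∀ {x y} → x ⊑ y → rank₀ x ≤ rank₀ y
  rank₀-monotone {a s} {a t} refl = ≤-refl
  rank₀-monotone {b s} {b t} refl = ≤-refl
  rank₀-monotone {a s} {b t} s≢t = <⇒≤ (odd<even (α<β⁺ s≢t))

  extension : LinearExtension N
  extension = record { rank = rank₀ ; rank-injective = rank₀-injective ; rank-monotone = rank₀-monotone }

  reverses : rank₀ (b k) < rank₀ (a k)
  reverses = subst (λ v → 2 * v < suc (2 * α k)) (sym (updateAt-updates k _)) (n<1+n _)

  a-order : ∀ {s t} → rank₀ (a s) ≤ rank₀ (a t) → α s ≤ α t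
  a-order {s} {t} = *-cancelˡ-≤ {α s} {α t} 2 ∘ s≤s⁻¹

  b-order : ∀ {s t} → rank₀ (b s) ≤ rank₀ (b t) → β s ≤ β t
  b-order {s} {t} = β⁺-order ∘ *-cancelˡ-≤ {β⁺ s} {β⁺ t} 2

  a-top : ∀ {t} → rank₀ (a k) ≤ rank₀ (a t) → t ≡ k
  a-top = maximalAt-unique α-max ∘ a-order

  b-bottom : ∀ {s} → rank₀ (b s) ≤ rank₀ (b k) → s ≡ k
  b-bottom = minimalAt-unique β-min ∘ b-order

  b≤a⇒≡ : ∀ {s t} → rank₀ (b s) ≤ rank₀ (a t) → s ≡ k
  b≤a⇒≡ {s} {t} le with s ≟ k
  ... | yes s≡k = s≡k
  ... | no s≢k = contradiction le (<⇒≱ (odd<even (subst (α t <_) (sym (updateAt-minimal s k _ s≢k))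
                                         (<-≤-trans (α<B t) (m≤m+n B (β s))))))

module PairRealizer {N : ℕ} {k₀ k₁ : Fin N} (k₀≢k₁ : k₀ ≢ k₁) where
  open Pinned k₀≢k₁

  α α̅ : Fin N → ℕ
  α = pinned
  α̅ t = suc N ∸ α t

  α̅-injective : Injective _≡_ _≡_ α̅
  α̅-injective = complement-injective pinned-≤ pinned-injective

  α-α̅-opposite : Opposite α α̅
  α-α̅-opposite = complement-opposite pinned-≤ pinned-injective

  module L₀ = Reversing (suc (suc N)) pinned-injective α̅-injective (s≤s ∘ pinned-≤)
                pinned-maximalAt (complement-minimalAt pinned-≤ pinned-maximalAt)
  module L₁ = Reversing (suc (suc N)) α̅-injective pinned-injective (λ t → s≤s (m∸n≤m (suc N) (α t)))
                (complement-maximalAt pinned-≤ pinned-minimalAt) pinned-minimalAt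

  extensions : Fin 2 → LinearExtension N
  extensions 0F = L₀.extension
  extensions (1F) = L₁.extension

  realizes : ∀ {S : Elem N → Set} → (∀ t → S (a t) → S (b t) → t ≡ k₀ ⊎ t ≡ k₁) → Realizes S extensions
  realizes _ {a s} {a t} _ _ ≤ₖ = α-α̅-opposite (L₀.a-order (≤ₖ 0F)) (L₁.a-order (≤ₖ 1F))
  realizes _ {b s} {b t} _ _ ≤ₖ = α-α̅-opposite (L₁.b-order (≤ₖ 1F)) (L₀.b-order (≤ₖ 0F))
  realizes critical {a s} {b t} sa sb ≤ₖ with s ≟ t
  ... | no s≢t = s≢t
  ... | yes refl with critical s sa sb
  ...   | inj₁ refl = contradiction (≤ₖ 0F) (<⇒≱ L₀.reverses)
  ...   | inj₂ refl = contradiction (≤ₖ 1F) (<⇒≱ L₁.reverses)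
  realizes _ {b s} {a t} _ _ ≤ₖ = k₀≢k₁ (trans (sym (L₀.b≤a⇒≡ (≤ₖ 0F))) (L₁.b≤a⇒≡ (≤ₖ 1F)))

module StandardRealizer {N : ℕ} (other : ∀ (t : Fin N) → ∃ λ u → t ≢ u) where
  module L (k : Fin N) = PairRealizer.L₀ (proj₂ (other k))

  extensions : Fin N → LinearExtension N
  extensions k = L.extension k

  realizes : Realizes (λ _ → ⊤) extensions
  realizes {a s} {a t} _ _ ≤ₖ = sym (L.a-top s (≤ₖ s))
  realizes {b s} {b t} _ _ ≤ₖ = L.b-bottom t (≤ₖ t)
  realizes {a s} {b t} _ _ ≤ₖ with s ≟ t
  ... | yes refl = contradiction (≤ₖ s) (<⇒≱ (L.reverses s))
  ... | no s≢t = s≢t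
  realizes {b s} {a t} _ _ ≤ₖ = proj₂ (other s) (L.b≤a⇒≡ (proj₁ (other s)) (≤ₖ (proj₁ (other s))))

incomparable⇒2≤ : ∀ {n} {_≼_ : Fin n → Fin n → Set} {S : Fin n → Set} {d} → Realizer _≼_ S d →
                  ∀ {x y} → S x → S y → ¬ x ≼ y → ¬ y ≼ x → 2 ≤ d
incomparable⇒2≤ {d = zero} (_ , _ , _ , realizes) sx sy x⋠y _ = contradiction (realizes sx sy (λ ())) x⋠y
incomparable⇒2≤ {d = suc zero} (σ , _ , _ , realizes) {x} {y} sx sy x⋠y y⋠x with σ 0F x ≤? σ 0F y
... | yes ≤₀ = contradiction (realizes sx sy λ { 0F → ≤₀ }) x⋠y
... | no ≰ = contradiction (realizes sy sx λ { 0F → <⇒≤ (≰⇒> ≰) }) y⋠x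
incomparable⇒2≤ {d = suc (suc d)} _ _ _ _ _ = s≤s (s≤s z≤n)

-- From S_N to an m-partite poset

module GroundSet (N : ℕ) where
  toElem : Fin (N + N) → Elem N
  toElem = splitAt N

  fromElem : Elem N → Fin (N + N)
  fromElem = join N N

  _≼_ : Fin (N + N) → Fin (N + N) → Set
  x ≼ y = toElem x ⊑ toElem y

  toElem-injective : Injective _≡_ _≡_ toElem
  toElem-injective {x} {y} eq = trans (sym (join-splitAt N N x)) (trans (cong fromElem eq) (join-splitAt N N y))

  ⊑⇒≼ : ∀ {z w} → z ⊑ w → fromElem z ≼ fromElem w
  ⊑⇒≼ = subst₂ _⊑_ (sym (splitAt-join N N _)) (sym (splitAt-join N N _))

  ≼⇒⊑ : ∀ {z w} → fromElem z ≼ fromElem w → z ⊑ w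
  ≼⇒⊑ = subst₂ _⊑_ (splitAt-join N N _) (splitAt-join N N _)

  realizer : ∀ {d S} (L : Fin d → LinearExtension N) → Realizes S L → Realizer _≼_ (S ∘ toElem) d
  realizer L realizes = (λ k → rank (L k) ∘ toElem)
                      , (λ k _ _ → toElem-injective ∘ rank-injective (L k))
                      , (λ k _ _ → rank-monotone (L k))
                      , realizes

  linearExtensions : ∀ {d} → Realizer _≼_ (λ _ → ⊤) d → Σ (Fin d → LinearExtension N) (Realizes (λ _ → ⊤))
  linearExtensions (σ , linear , monotone , realizes) =
    (λ k → record
      { rank = σ k ∘ fromElem
      ; rank-injective = λ {z} {w} eq →
          trans (sym (splitAt-join N N z)) (trans (cong toElem (linear k tt tt eq)) (splitAt-join N N w))
      ; rank-monotone = monotone k tt tt ∘ ⊑⇒≼ })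
    , λ _ _ ≤ₖ → ≼⇒⊑ (realizes tt tt ≤ₖ)

  dim-N : (∀ t → ∃ λ u → t ≢ u) → IsDim _≼_ (λ _ → ⊤) N
  dim-N other = realizer extensions realizes , λ _ → uncurry standardExample-dim≥ ∘ linearExtensions
    where open StandardRealizer other

  dim-2 : ∀ {S : Elem N → Set} {k₀ k₁} → k₀ ≢ k₁ → (∀ t → S (a t) → S (b t) → t ≡ k₀ ⊎ t ≡ k₁) →
          ∀ z w → S z → S w → ¬ z ⊑ w → ¬ w ⊑ z → IsDim _≼_ (S ∘ toElem) 2
  dim-2 {S} k₀≢k₁ critical _ _ sz sw z⋢w w⋢z =
    realizer extensions (realizes {S} critical) ,
    λ _ r → incomparable⇒2≤ r (subst S (sym (splitAt-join N N _)) sz) (subst S (sym (splitAt-join N N _)) sw)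
                              (z⋢w ∘ ≼⇒⊑) (w⋢z ∘ ≼⇒⊑)
    where open PairRealizer k₀≢k₁

module Layered {N M : ℕ} (layer : Elem N → Fin M) (a<b : ∀ s t → layer (a s) Fin.< layer (b t))
               (onto : ∀ p → ∃ λ z → layer z ≡ p) where
  open GroundSet N

  antichain : ∀ {z w} → z ⊑ w → layer z ≡ layer w → z ≡ w
  antichain {a s} {a t} refl _ = refl
  antichain {b s} {b t} refl _ = refl
  antichain {a s} {b t} _ eq = contradiction eq (<⇒≢ᶠ (a<b s t))

  layered : ∀ {z w} → z ⊑ w → z ≢ w → layer z Fin.< layer w
  layered {a s} {a t} refl z≢w = contradiction refl z≢w
  layered {b s} {b t} refl z≢w = contradiction refl z≢w
  layered {a s} {b t} _ _ = a<b s t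

  poset : MPartitePoset M
  poset = record
    { n = N + N
    ; part = layer ∘ toElem
    ; nonempty = λ p → fromElem (proj₁ (onto p)) , trans (cong layer (splitAt-join N N _)) (proj₂ (onto p))
    ; _≼_ = _≼_
    ; ≼-refl = ⊑-refl ∘ toElem
    ; ≼-antisym = λ x≼y y≼x → toElem-injective (⊑-antisym x≼y y≼x)
    ; ≼-trans = ⊑-trans
    ; antichain = λ x≼y eq → toElem-injective (antichain x≼y eq)
    ; layered = λ x≼y x≢y → layered x≼y (x≢y ∘ toElem-injective)
    }

data Side (h c : ℕ) : Fin (h + c) → Set where
  left  : (i : Fin h) → Side h c (i ↑ˡ c)
  right : (j : Fin c) → Side h c (h ↑ʳ j)

side : ∀ h c (p : Fin (h + c)) → Side h c p
side h c p with splitAt h p in eq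
... | inj₁ i = subst (Side h c) (splitAt⁻¹-↑ˡ eq) (left i)
... | inj₂ j = subst (Side h c) (splitAt⁻¹-↑ʳ eq) (right j)

module _ {h c : ℕ} where

  ↑ˡ<↑ʳ : ∀ (i : Fin h) (j : Fin c) → i ↑ˡ c Fin.< h ↑ʳ j
  ↑ˡ<↑ʳ i j = subst₂ _<_ (sym (toℕ-↑ˡ i c)) (sym (toℕ-↑ʳ h j)) (<-≤-trans (toℕ<n i) (m≤m+n h (toℕ j)))

  ↑ˡ≢↑ʳ : ∀ (i : Fin h) (j : Fin c) → i ↑ˡ c ≢ h ↑ʳ j
  ↑ˡ≢↑ʳ i j = <⇒≢ᶠ (↑ˡ<↑ʳ i j)

module Blowup (h c : ℕ) (i₀ : Fin h) (j₀ : Fin c) where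
  N : ℕ
  N = h * c * 2

  index : Fin h → Fin c → Fin 2 → Fin N
  index i j s = combine (combine i j) s

  lower : Fin N → Fin h
  lower t = proj₁ (remQuot {h} c (proj₁ (remQuot {h * c} 2 t)))

  upper : Fin N → Fin c
  upper t = proj₂ (remQuot {h} c (proj₁ (remQuot {h * c} 2 t)))

  lower-index : ∀ i j s → lower (index i j s) ≡ i
  lower-index i j s = trans (cong (proj₁ ∘ remQuot {h} c ∘ proj₁) (remQuot-combine (combine i j) s))
                            (cong proj₁ (remQuot-combine i j))

  upper-index : ∀ i j s → upper (index i j s) ≡ j
  upper-index i j s = trans (cong (proj₂ ∘ remQuot {h} c ∘ proj₁) (remQuot-combine (combine i j) s))
                            (cong proj₂ (remQuot-combine i j))

  index-copies-distinct : ∀ i j → index i j 0F ≢ index i j (1F)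
  index-copies-distinct i j eq with
    trans (sym (cong proj₂ (remQuot-combine (combine i j) 0F)))
          (trans (cong (proj₂ ∘ remQuot {h * c} 2) eq) (cong proj₂ (remQuot-combine (combine i j) (1F))))
  ... | ()

  index-decode : ∀ t → t ≡ index (lower t) (upper t) (proj₂ (remQuot {h * c} 2 t))
  index-decode t = trans (sym (combine-remQuot {h * c} 2 t))
    (cong (λ x → combine x (proj₂ (remQuot {h * c} 2 t))) (sym (combine-remQuot {h} c (proj₁ (remQuot {h * c} 2 t)))))

  index-copies : ∀ {t i j} → lower t ≡ i → upper t ≡ j → t ≡ index i j 0F ⊎ t ≡ index i j (1F)
  index-copies {t} refl refl with proj₂ (remQuot {h * c} 2 t) | index-decode t
  ... | 0F | t≡ = inj₁ t≡
  ... | 1F | t≡ = inj₂ t≡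

  layer : Elem N → Fin (h + c)
  layer (a t) = lower t ↑ˡ c
  layer (b t) = h ↑ʳ upper t

  onto : ∀ p → ∃ λ z → layer z ≡ p
  onto p with side h c p
  ... | left i = a (index i j₀ 0F) , cong (_↑ˡ c) (lower-index i j₀ 0F)
  ... | right j = b (index i₀ j 0F) , cong (h ↑ʳ_) (upper-index i₀ j 0F)

  open Layered layer (λ s t → ↑ˡ<↑ʳ (lower s) (upper t)) onto public using (poset)
  open GroundSet N

  index-injectiveˡ : ∀ {i i′ j j′ s s′} → index i j s ≡ index i′ j′ s′ → i ≡ i′
  index-injectiveˡ {i} {i′} {j} {j′} {s} {s′} eq =
    trans (sym (lower-index i j s)) (trans (cong lower eq) (lower-index i′ j′ s′))

  index-injectiveʳ : ∀ {i i′ j j′ s s′} → index i j s ≡ index i′ j′ s′ → j ≡ j′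
  index-injectiveʳ {i} {i′} {j} {j′} {s} {s′} eq =
    trans (sym (upper-index i j s)) (trans (cong upper eq) (upper-index i′ j′ s′))

  InLayers : Fin (h + c) → Fin (h + c) → Elem N → Set
  InLayers p q z = layer z ≡ p ⊎ layer z ≡ q

  dim-left-left : ∀ {i i′} → i ≢ i′ → IsDim _≼_ (InPair poset (i ↑ˡ c) (i′ ↑ˡ c)) 2
  dim-left-left {i} {i′} i≢i′ =
    dim-2 {S = InLayers (i ↑ˡ c) (i′ ↑ˡ c)} (index-copies-distinct i j₀)
      (λ _ _ sb → contradiction sb [ ≢-sym (↑ˡ≢↑ʳ _ _) , ≢-sym (↑ˡ≢↑ʳ _ _) ])
      (a (index i j₀ 0F)) (a (index i′ j₀ 0F))
      (inj₁ (cong (_↑ˡ c) (lower-index i j₀ 0F))) (inj₂ (cong (_↑ˡ c) (lower-index i′ j₀ 0F)))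
      (i≢i′ ∘ index-injectiveˡ) (i≢i′ ∘ sym ∘ index-injectiveˡ)

  dim-right-right : ∀ {j j′} → j ≢ j′ → IsDim _≼_ (InPair poset (h ↑ʳ j) (h ↑ʳ j′)) 2
  dim-right-right {j} {j′} j≢j′ =
    dim-2 {S = InLayers (h ↑ʳ j) (h ↑ʳ j′)} (index-copies-distinct i₀ j)
      (λ _ sa _ → contradiction sa [ ↑ˡ≢↑ʳ _ _ , ↑ˡ≢↑ʳ _ _ ])
      (b (index i₀ j 0F)) (b (index i₀ j′ 0F))
      (inj₁ (cong (h ↑ʳ_) (upper-index i₀ j 0F))) (inj₂ (cong (h ↑ʳ_) (upper-index i₀ j′ 0F)))
      (j≢j′ ∘ index-injectiveʳ) (j≢j′ ∘ sym ∘ index-injectiveʳ)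

  dim-left-right : ∀ i j → IsDim _≼_ (InPair poset (i ↑ˡ c) (h ↑ʳ j)) 2
  dim-left-right i j =
    dim-2 {S = InLayers (i ↑ˡ c) (h ↑ʳ j)} (index-copies-distinct i j)
      (λ _ sa sb → index-copies (in-left sa) (in-right sb))
      (a (index i j 0F)) (b (index i j 0F))
      (inj₁ (cong (_↑ˡ c) (lower-index i j 0F))) (inj₂ (cong (h ↑ʳ_) (upper-index i j 0F)))
      (λ k≢k → k≢k refl) (λ ())
    where
    in-left : ∀ {x} → x ↑ˡ c ≡ i ↑ˡ c ⊎ x ↑ˡ c ≡ h ↑ʳ j → x ≡ i
    in-left (inj₁ eq) = ↑ˡ-injective c _ _ eq
    in-left (inj₂ eq) = contradiction eq (↑ˡ≢↑ʳ _ _)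
    in-right : ∀ {y} → h ↑ʳ y ≡ i ↑ˡ c ⊎ h ↑ʳ y ≡ h ↑ʳ j → y ≡ j
    in-right (inj₁ eq) = contradiction (sym eq) (↑ˡ≢↑ʳ _ _)
    in-right (inj₂ eq) = ↑ʳ-injective h _ _ eq

  dim-pair : ∀ p q → p Fin.< q → IsDim _≼_ (InPair poset p q) 2
  dim-pair p q p<q with side h c p | side h c q
  ... | left i  | left i′  = dim-left-left λ { refl → <-irrefl refl p<q }
  ... | left i  | right j  = dim-left-right i j
  ... | right j | right j′ = dim-right-right λ { refl → <-irrefl refl p<q }
  ... | right j | left i   = contradiction p<q (<-asym (↑ˡ<↑ʳ i j))

  isB : IsB poset 2
  isB = (λ p q p<q → 2 , dim-pair p q p<q , ≤-refl)
      , i₀ ↑ˡ c , h ↑ʳ j₀ , ↑ˡ<↑ʳ i₀ j₀ , dim-pair _ _ (↑ˡ<↑ʳ i₀ j₀)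

  dimP : DimP poset N
  dimP = dim-N (another (index-copies-distinct i₀ j₀))

m<n*o⇒m*2<n*2*o : ∀ {m n o} → m < n * o → m * 2 < n * 2 * o
m<n*o⇒m*2<n*2*o {m} {n} {o} m<no = subst (m * 2 <_) n*o*2≡n*2*o (*-monoˡ-< 2 m<no)
  where
  open ≡-Reasoning
  n*o*2≡n*2*o : n * o * 2 ≡ n * 2 * o
  n*o*2≡n*2*o = begin
    n * o * 2    ≡⟨ *-assoc n o 2 ⟩
    n * (o * 2)  ≡⟨ cong (n *_) (*-comm o 2) ⟩
    n * (2 * o)  ≡⟨ *-assoc n 2 o ⟨
    n * 2 * o    ∎

theorem2 : (m : ℕ) → 2 ≤ m → (p q : ℕ) → 0 < q → p < ⌊ m /2⌋ * ⌈ m /2⌉ * q →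
    ∃ λ (P : MPartitePoset m) → ∃ λ d → ∃ λ b →
      DimP P d × IsB P b × p * b < d * q
theorem2 m@(suc (suc _)) (s≤s (s≤s z≤n)) p q _ p<hcq =
  subst Witness (⌊n/2⌋+⌈n/2⌉≡n m) (poset , N , 2 , dimP , isB , m<n*o⇒m*2<n*2*o {n = ⌊ m /2⌋ * ⌈ m /2⌉} p<hcq)
  where
  open Blowup ⌊ m /2⌋ ⌈ m /2⌉ 0F 0F
  Witness : ℕ → Set₁
  Witness m = ∃ λ (P : MPartitePoset m) → ∃ λ d → ∃ λ b → DimP P d × IsB P b × p * b < d * q
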